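{- The following hold constructively: (1) $\mathbf{LPO}[\mathcal{R}]$; (2) $\mathbb{P}$-$\mathbf{LPO}[\mathcal{R}]$; (3) $\mathbb{PP}$-$\mathbf{LPO}[\mathcal{R}]$; (4) $\mathbb{PP}$-$\mathbf{LPO}[\mathcal{N}]$; (5) $\mathbb{P}$-$\mathbf{LPO}[\mathcal{N}]$; (6) $\neg\,\mathbb{PP}$-$\mathbf{LPO}[\mathcal{P}]$.
   Context: Constructive (Bishop-style) setting. A potential event is a sequence $\mathsf{e}:\mathbb{N}^{+}\to\{0,1\}$; $\mathcal{P}$ is the set of potential events with extensional equality. Define $\Phi(\mathsf{e})(n)=\frac{\sum_{i=1}^{n}\mathsf{e}(i)}{n}$. An actual event is a pair $(\mathsf{e},\gamma)$ with $\gamma:\mathbb{N}^{+}\to\mathbb{N}^{+}$ strictly increasing and $|\Phi(\mathsf{e})(\gamma(n)+i)-\Phi(\mathsf{e})(\gamma(n)+j)|\le\frac1n$ for all $n\in\mathbb{N}^{+}$, $i,j\in\mathbb{N}$; $\mathbb{P}(\mathsf{e},\gamma):=\Phi(\mathsf{e})\circ\gamma$, a Bishop real (sequence $x:\mathbb{N}^{+}\to\mathbb{Q}$ with $|x(n)-x(m)|\le\frac1n+\frac1m$; $x=_{\mathbb{R}}0$ iff $|x(n)|\le\frac2n$ for all $n$; $x>0$ iff $x(n)>\frac1n$ for some $n$). $\mathcal{A}$ is the set of $\mathsf{e}$ for which some $\gamma$ makes $(\mathsf{e},\gamma)$ actual; $\varphi(\mathbb{P}[\mathsf{e}])$ means $\mathsf{e}\in\mathcal{A}$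 and $\varphi(\mathbb{P}(\mathsf{e},\gamma))$ for every $\gamma$ making $(\mathsf{e},\gamma)$ actual. $\mathcal{N}=\{\mathsf{e}:\mathbb{P}[\mathsf{e}]=_{\mathbb{R}}0\}$. For finite lists $\bm{\alpha}$ (length $\ell(\bm{\alpha})\ge0$) and $\bm{\pi}$ (length $\ell(\bm{\pi})>0$) over $\{0,1\}$, $\|\bm{\alpha},\bm{\pi}\|(i)=\alpha_i$ for $i\le\ell(\bm{\alpha})$ and $=\pi_{\mathsf{rm}(i-\ell(\bm{\alpha})-1,\ell(\bm{\pi}))+1}$ for $i>\ell(\bm{\alpha})$ ($\mathsf{rm}$ = remainder); $\mathcal{R}$ is the set of $\mathsf{e}$ equal to some $\|\bm{\alpha},\bm{\pi}\|$. Principles, for $\mathcal{E}\subseteq\mathcal{P}$: $\mathbf{LPO}[\mathcal{E}]$: for all $\mathsf{e}\in\mathcal{E}$, $(\forall n\,\mathsf{e}(n)=0)\vee(\exists n\,\mathsf{e}(n)=1)$. $\mathbb{P}$-$\mathbf{LPO}[\mathcal{E}]$: for all $\mathsf{e}\in\mathcal{E}$, $\mathbb{P}[\mathsf{e}]=_{\mathbb{R}}0\vee(\exists n\,\mathsf{e}(n)=1)$. $\mathbb{PP}$-$\mathbf{LPO}[\mathcal{E}]$: for all $\mathsf{e}\in\mathcal{E}$, $\mathbb{P}[\mathsf{e}]=_{\mathbb{R}}0\vee\mathbb{P}[\mathsf{e}]>0$. -}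

module Defs where

open import Data.Bool using (Bool; true; false; if_then_else_)
open import Data.Nat as ℕ using (ℕ; zero; suc; NonZero; _∸_; _%_)
open import Data.Nat.Base using () renaming (_+_ to _+ℕ_; _≤ᵇ_ to _≤ᵇ_)
open import Data.Integer using (+_)
open import Data.Rational using (ℚ; 0ℚ; _/_; _-_; ∣_∣; _≤_; _<_) renaming (_+_ to _+ℚ_)
open import Data.List using (List; []; _∷_; length)
open import Data.Product using (Σ; _×_; ∃)
open import Data.Sum using (_⊎_)
open import Data.Unit using (⊤)
open import Relation.Binary.PropositionalEquality using (_≡_)

-- Potential events: e : ℕ⁺ → {0,1}, represented as ℕ → Bool (true = 1,
-- false = 0); the value at index 0 is junk and never used: every
-- quantifier over ℕ⁺ is "∀ n → NonZero n → ...".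
Event : Set
Event = ℕ → Bool

bit : Bool → ℕ
bit true  = 1
bit false = 0

count : Event → ℕ → ℕ
count e zero    = 0
count e (suc n) = count e n +ℕ bit (e (suc n))

-- k / n as a rational, for n ∈ ℕ⁺ (junk value 0 at n = 0, never used)
frac : ℕ → ℕ → ℚ
frac k zero    = 0ℚ
frac k (suc n) = + k / suc n

Φ : Event → ℕ → ℚ
Φ e n = frac (count e n) n

IsIndexMap : (ℕ → ℕ) → Set
IsIndexMap γ =
  ((n : ℕ) → NonZero n → NonZero (γ n)) ×
  ((m n : ℕ) → NonZero m → NonZero n → m ℕ.< n → γ m ℕ.< γ n)

Actual : Event → (ℕ → ℕ) → Set
Actual e γ = IsIndexMap γ ×
  ((n : ℕ) → NonZero n → (i j : ℕ) →
     ∣ Φ e (γ n +ℕ i) - Φ e (γ n +ℕ j) ∣ ≤ frac 1 n)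

ℙ : Event → (ℕ → ℕ) → (ℕ → ℚ)
ℙ e γ n = Φ e (γ n)

InA : Event → Set
InA e = Σ (ℕ → ℕ) λ γ → Actual e γ

-- φ(ℙ[e]) : e ∈ 𝒜 and φ(ℙ(e,γ)) for every γ making (e,γ) actual
Holds : ((ℕ → ℚ) → Set) → Event → Set
Holds φ e = InA e × ((γ : ℕ → ℕ) → Actual e γ → φ (ℙ e γ))

-- Bishop reals (sequences indexed by ℕ⁺; index 0 ignored)
EqZero : (ℕ → ℚ) → Set
EqZero x = (n : ℕ) → NonZero n → ∣ x n ∣ ≤ frac 2 n

Positive : (ℕ → ℚ) → Set
Positive x = Σ ℕ λ n → NonZero n × (frac 1 n < x n)

InN : Event → Set
InN e = Holds EqZero e

InP : Event → Set
InP e = ⊤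

at : List Bool → ℕ → Bool
at []       _       = false
at (x ∷ xs) zero    = x
at (x ∷ xs) (suc k) = at xs k

-- ‖α , π‖(i) for i ∈ ℕ⁺ (π nonempty; junk false if π = [])
‖_,_‖ : List Bool → List Bool → Event
‖ α , [] ‖ i = false
‖ α , π@(_ ∷ _) ‖ i =
  if i ≤ᵇ length α then at α (i ∸ 1)
  else at π ((i ∸ length α ∸ 1) % length π)

InR : Event → Set
InR e = Σ (List Bool) λ α → Σ (List Bool) λ π →
  (0 ℕ.< length π) × ((i : ℕ) → NonZero i → e i ≡ ‖ α , π ‖ i)

SomeOne : Event → Set
SomeOne e = Σ ℕ λ n → NonZero n × (e n ≡ true)

LPO : (Event → Set) → Set
LPO E = (e : Event) → E e →
  ((n : ℕ) → NonZero n → e n ≡ false) ⊎ SomeOne e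

ℙ-LPO : (Event → Set) → Set
ℙ-LPO E = (e : Event) → E e → Holds EqZero e ⊎ SomeOne e

ℙℙ-LPO : (Event → Set) → Set
ℙℙ-LPO E = (e : Event) → E e → Holds EqZero e ⊎ Holds Positive e

module Submission where

-- Everything reduces to the counting function: a bound on |Φ e a - Φ e b| or on
-- Φ e a is a cross-multiplied inequality between counts. When den · count e m
-- stays within a constant of num · m, as it does for an eventually periodic event
-- (den the period, num the number of ones in it), the frequencies are Cauchy with
-- a modulus linear in n, so e is actual, and ℙ[e] is 0 when num = 0 and positive
-- otherwise; for e ∈ ℛ one can decide which case occurs by inspecting the finite
-- lists. On the other hand the event that is 1 exactly on the blocks
-- (4^k, 4^(k+1)] with k odd has frequency at most 1/4 at 4^(2j+1) and at least
-- 3/4 at 4^(2j+2), so it is not actual, whereas ℙℙ-LPO on 𝒫 would make it so.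

open import Data.Bool using (Bool; true; false; not; if_then_else_; T)
open import Data.Bool.Properties using (T-≡)
open import Data.Integer as ℤ using (+_; _⊖_)
import Data.Integer.Properties as ℤ
open import Data.List using (List; []; _∷_; length)
open import Data.Nat as ℕ
  using (ℕ; zero; suc; NonZero; z≤n; s≤s; _+_; _*_; _∸_; _%_; _≤_; _<_; _≤ᵇ_; _^_; _/_)
open import Data.Nat.DivMod using (m<n⇒m%n≡m; [m+n]%n≡m%n; m*n/n≡m; /-monoˡ-≤; m<n*o⇒m/o<n)
open import Data.Nat.Induction using (<-rec)
open import Data.Nat.Properties
open import Algebra.Properties.CommutativeSemigroup +-commutativeSemigroup using (xy∙z≈xz∙y)
open import Data.Nat.Tactic.RingSolver using (solve-∀)
open import Data.Product using (_×_; _,_; proj₁; proj₂; Σ)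
import Data.Rational as ℚ
import Data.Rational.Properties as ℚ
open import Data.Rational.Unnormalised as ℚᵘ using (mkℚᵘ; *≤*; *<*)
import Data.Rational.Unnormalised.Properties as ℚᵘ
open import Data.Sum using (_⊎_; inj₁; inj₂; [_,_])
open import Data.Unit using (tt)
open import Defs
open import Function.Base using (_∘_)
open import Function.Bundles using (Equivalence)
open import Relation.Binary.PropositionalEquality hiding ([_])
open import Relation.Nullary using (¬_; yes; no; contradiction)

-- Rational frequencies as natural-number inequalities

toℚᵘ-frac : ∀ k a → ℚ.toℚᵘ (frac k (suc a)) ℚᵘ.≃ mkℚᵘ (+ k) a
toℚᵘ-frac k a = ℚ.toℚᵘ-fromℚᵘ (mkℚᵘ (+ k) a)

toℚᵘ-∣frac-frac∣ : ∀ k a l b →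
  ℚ.toℚᵘ (ℚ.∣ frac k (suc a) ℚ.- frac l (suc b) ∣) ℚᵘ.≃ ℚᵘ.∣ mkℚᵘ (+ k) a ℚᵘ.- mkℚᵘ (+ l) b ∣
toℚᵘ-∣frac-frac∣ k a l b = ℚᵘ.≃-trans (ℚ.toℚᵘ-homo-∣-∣ (x ℚ.- y))
  (ℚᵘ.∣-∣-cong (ℚᵘ.≃-trans (ℚ.toℚᵘ-homo-+ x (ℚ.- y))
    (ℚᵘ.+-cong (toℚᵘ-frac k a) (ℚᵘ.≃-trans (ℚ.toℚᵘ-homo‿- y) (ℚᵘ.-‿cong (toℚᵘ-frac l b))))))
  where
  x = frac k (suc a)
  y = frac l (suc b)

cross-difference : ∀ k a l b →
  + k ℤ.* + suc b ℤ.+ ℤ.- (+ l) ℤ.* + suc a ≡ k * suc b ⊖ l * suc a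
cross-difference k a l b = begin
  + k ℤ.* + suc b ℤ.+ ℤ.- (+ l) ℤ.* + suc a
    ≡⟨ cong₂ ℤ._+_ (sym (ℤ.pos-* k (suc b))) (sym (ℤ.neg-distribˡ-* (+ l) (+ suc a))) ⟩
  + (k * suc b) ℤ.+ ℤ.- (+ l ℤ.* + suc a)
    ≡⟨ cong (λ z → + (k * suc b) ℤ.+ ℤ.- z) (sym (ℤ.pos-* l (suc a))) ⟩
  + (k * suc b) ℤ.+ ℤ.- + (l * suc a)
    ≡⟨ ℤ.m-n≡m⊖n (k * suc b) (l * suc a) ⟩
  k * suc b ⊖ l * suc a ∎
  where open ≡-Reasoning

scaled-cross-difference : ∀ k a l b n →
  + ℤ.∣ + k ℤ.* + suc b ℤ.+ ℤ.- (+ l) ℤ.* + suc a ∣ ℤ.* + suc n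
    ≡ + (ℤ.∣ k * suc b ⊖ l * suc a ∣ * suc n)
scaled-cross-difference k a l b n =
  trans (sym (ℤ.pos-* ℤ.∣ difference ∣ (suc n)))
        (cong (λ z → + (ℤ.∣ z ∣ * suc n)) (cross-difference k a l b))
  where
  difference = + k ℤ.* + suc b ℤ.+ ℤ.- (+ l) ℤ.* + suc a

∣frac-frac∣≤frac⇒ : ∀ k a l b n →
  ℚ.∣ frac k (suc a) ℚ.- frac l (suc b) ∣ ℚ.≤ frac 1 (suc n) →
  ℤ.∣ k * suc b ⊖ l * suc a ∣ * suc n ≤ suc a * suc b
∣frac-frac∣≤frac⇒ k a l b n le
  with ℚᵘ.≤-respʳ-≃ (toℚᵘ-frac 1 n) (ℚᵘ.≤-respˡ-≃ (toℚᵘ-∣frac-frac∣ k a l b) (ℚ.toℚᵘ-mono-≤ le))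
... | *≤* cross = ℤ.drop‿+≤+ (subst₂ ℤ._≤_ (scaled-cross-difference k a l b n) (ℤ.*-identityˡ _) cross)

∣frac-frac∣≤frac⇐ : ∀ k a l b n →
  ℤ.∣ k * suc b ⊖ l * suc a ∣ * suc n ≤ suc a * suc b →
  ℚ.∣ frac k (suc a) ℚ.- frac l (suc b) ∣ ℚ.≤ frac 1 (suc n)
∣frac-frac∣≤frac⇐ k a l b n le = ℚ.toℚᵘ-cancel-≤
  (ℚᵘ.≤-respʳ-≃ (ℚᵘ.≃-sym (toℚᵘ-frac 1 n))
    (ℚᵘ.≤-respˡ-≃ (ℚᵘ.≃-sym (toℚᵘ-∣frac-frac∣ k a l b))
      (*≤* (subst₂ ℤ._≤_ (sym (scaled-cross-difference k a l b n)) (sym (ℤ.*-identityˡ _)) (ℤ.+≤+ le)))))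

∣⊖∣*≤⇒ : ∀ x y k w → ℤ.∣ x ⊖ y ∣ * k ≤ w → x * k ≤ y * k + w
∣⊖∣*≤⇒ x y k w le with ≤-total x y
... | inj₁ x≤y = ≤-trans (*-monoˡ-≤ k x≤y) (m≤m+n (y * k) w)
... | inj₂ y≤x = ≤-trans (m≤n+m∸n (x * k) (y * k)) (+-monoʳ-≤ (y * k) (subst (_≤ w) diff le))
  where
  diff : ℤ.∣ x ⊖ y ∣ * k ≡ x * k ∸ y * k
  diff = trans (cong (_* k) (trans (ℤ.∣m⊖n∣≡∣n⊖m∣ x y) (ℤ.∣⊖∣-≤ y≤x))) (*-distribʳ-∸ k x y)

∣⊖∣*≤⇐ : ∀ x y k w → x * k ≤ y * k + w → y * k ≤ x * k + w → ℤ.∣ x ⊖ y ∣ * k ≤ w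
∣⊖∣*≤⇐ x y k w le₁ le₂ with ≤-total x y
... | inj₁ x≤y = subst (_≤ w) (sym (trans (cong (_* k) (ℤ.∣⊖∣-≤ x≤y)) (*-distribʳ-∸ k y x)))
                   (m≤n+o⇒m∸n≤o (y * k) (x * k) le₂)
... | inj₂ y≤x = subst (_≤ w) (sym (trans (cong (_* k) (trans (ℤ.∣m⊖n∣≡∣n⊖m∣ x y) (ℤ.∣⊖∣-≤ y≤x)))
                   (*-distribʳ-∸ k x y)))
                   (m≤n+o⇒m∸n≤o (x * k) (y * k) le₁)

frac-close⇒ : ∀ {k l a b n} .{{_ : NonZero a}} .{{_ : NonZero b}} .{{_ : NonZero n}} →
  ℚ.∣ frac k a ℚ.- frac l b ∣ ℚ.≤ frac 1 n → k * b * n ≤ l * a * n + a * b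
frac-close⇒ {k} {l} {suc a} {suc b} {suc n} close =
  ∣⊖∣*≤⇒ (k * suc b) (l * suc a) (suc n) _ (∣frac-frac∣≤frac⇒ k a l b n close)

frac-close⇐ : ∀ {k l a b n} .{{_ : NonZero a}} .{{_ : NonZero b}} .{{_ : NonZero n}} →
  k * b * n ≤ l * a * n + a * b → l * a * n ≤ k * b * n + b * a →
  ℚ.∣ frac k a ℚ.- frac l b ∣ ℚ.≤ frac 1 n
frac-close⇐ {k} {l} {suc a} {suc b} {suc n} le₁ le₂ =
  ∣frac-frac∣≤frac⇐ k a l b n (∣⊖∣*≤⇐ (k * suc b) (l * suc a) (suc n) _ le₁ le₂′)
  where
  le₂′ = subst (λ w → l * suc a * suc n ≤ k * suc b * suc n + w) (*-comm (suc b) (suc a)) le₂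

∣frac∣≤frac2 : ∀ {k a n} .{{_ : NonZero a}} .{{_ : NonZero n}} →
  k * n ≤ 2 * a → ℚ.∣ frac k a ∣ ℚ.≤ frac 2 n
∣frac∣≤frac2 {k} {suc a} {suc n} le = ℚ.toℚᵘ-cancel-≤
  (ℚᵘ.≤-respʳ-≃ (ℚᵘ.≃-sym (toℚᵘ-frac 2 n))
    (ℚᵘ.≤-respˡ-≃
      (ℚᵘ.≃-sym (ℚᵘ.≃-trans (ℚ.toℚᵘ-homo-∣-∣ (frac k (suc a))) (ℚᵘ.∣-∣-cong (toℚᵘ-frac k a))))
      (*≤* (subst₂ ℤ._≤_ (ℤ.pos-* k (suc n)) (ℤ.pos-* 2 (suc a)) (ℤ.+≤+ le)))))

frac1<frac : ∀ {k a n} .{{_ : NonZero a}} .{{_ : NonZero n}} →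
  a < k * n → frac 1 n ℚ.< frac k a
frac1<frac {k} {suc a} {suc n} lt = ℚ.toℚᵘ-cancel-<
  (ℚᵘ.<-respʳ-≃ (ℚᵘ.≃-sym (toℚᵘ-frac k a)) (ℚᵘ.<-respˡ-≃ (ℚᵘ.≃-sym (toℚᵘ-frac 1 n))
    (*<* (subst₂ ℤ._<_ (ℤ.pos-* 1 (suc a)) (ℤ.pos-* k (suc n))
      (ℤ.+<+ (subst (_< k * suc n) (sym (*-identityˡ (suc a))) lt))))))

bit≤1 : ∀ b → bit b ≤ 1
bit≤1 true  = ≤-refl
bit≤1 false = z≤n

count≤ : ∀ e m → count e m ≤ m
count≤ e zero    = z≤n
count≤ e (suc m) = subst (_≤ suc m) (+-comm (bit (e (suc m))) (count e m))
  (+-mono-≤ (bit≤1 (e (suc m))) (count≤ e m))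

count-mono-+ : ∀ e d m → count e m ≤ count e (d + m)
count-mono-+ e zero    m = ≤-refl
count-mono-+ e (suc d) m = ≤-trans (count-mono-+ e d m) (m≤m+n _ _)

count-+≤ : ∀ e d m → count e (d + m) ≤ count e m + d
count-+≤ e zero    m = m≤m+n _ 0
count-+≤ e (suc d) m = ≤-trans (+-mono-≤ (count-+≤ e d m) (bit≤1 (e (suc (d + m)))))
  (≤-reflexive (trans (+-assoc (count e m) d 1) (cong (_+_ (count e m)) (+-comm d 1))))

count-false-block : ∀ e d m → (∀ t → t < d → e (suc (t + m)) ≡ false) →
  count e (d + m) ≡ count e m
count-false-block e zero    m all-false = refl
count-false-block e (suc d) m all-false rewrite all-false d (n<1+n d) =
  trans (+-identityʳ _) (count-false-block e d m (λ t t<d → all-false t (m<n⇒m<1+n t<d)))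

count-true-block : ∀ e d m → (∀ t → t < d → e (suc (t + m)) ≡ true) →
  count e (d + m) ≡ count e m + d
count-true-block e zero    m all-true = sym (+-identityʳ _)
count-true-block e (suc d) m all-true rewrite all-true d (n<1+n d) =
  trans (cong (_+ 1) (count-true-block e d m (λ t t<d → all-true t (m<n⇒m<1+n t<d))))
    (trans (+-assoc (count e m) d 1) (cong (_+_ (count e m)) (+-comm d 1)))

count-hit : ∀ e t m → e (suc (t + m)) ≡ true → count e m < count e (suc (t + m))
count-hit e t m hit rewrite hit =
  subst (count e m <_) (+-comm 1 (count e (t + m))) (s≤s (count-mono-+ e t m))

count≤-false-beyond : ∀ e L → (∀ i → L < i → e i ≡ false) → ∀ m → count e m ≤ L
count≤-false-beyond e L false-beyond zero = z≤n
count≤-false-beyond e L false-beyond (suc m) with suc m ≤? L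
... | yes m<L = ≤-trans (count≤ e (suc m)) m<L
... | no  m≮L rewrite false-beyond (suc m) (≰⇒> m≮L) =
  ≤-trans (≤-reflexive (+-identityʳ _)) (count≤-false-beyond e L false-beyond m)

nonZero-≤ : ∀ {m n} → NonZero m → m ≤ n → NonZero n
nonZero-≤ {m} m≢0 m≤n = ℕ.>-nonZero (≤-trans (ℕ.>-nonZero⁻¹ m {{m≢0}}) m≤n)

index-≥ : ∀ {γ} → IsIndexMap γ → ∀ n → NonZero n → n ≤ γ n
index-≥ {γ} (γ≢0 , _) 1 _ = ℕ.>-nonZero⁻¹ (γ 1) {{γ≢0 1 _}}
index-≥ {γ} γ-index@(_ , γ-mono) (suc (suc n)) _ =
  ≤-trans (s≤s (index-≥ γ-index (suc n) _)) (γ-mono (suc n) (suc (suc n)) _ _ ≤-refl)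

close-beyond : ∀ {e γ} → Actual e γ → ∀ n → NonZero n → ∀ {a b} → γ n ≤ a → γ n ≤ b →
  ℚ.∣ Φ e a ℚ.- Φ e b ∣ ℚ.≤ frac 1 n
close-beyond {e} {γ} (_ , cauchy) n n≢0 {a} {b} γn≤a γn≤b =
  subst₂ (λ x y → ℚ.∣ Φ e x ℚ.- Φ e y ∣ ℚ.≤ frac 1 n)
    (trans (+-comm (γ n) (a ∸ γ n)) (m∸n+n≡m γn≤a))
    (trans (+-comm (γ n) (b ∸ γ n)) (m∸n+n≡m γn≤b))
    (cauchy n n≢0 (a ∸ γ n) (b ∸ γ n))

count-close-beyond : ∀ {e γ} → Actual e γ → ∀ n → NonZero n → ∀ {a b} → γ n ≤ a → γ n ≤ b →
  count e a * b * n ≤ count e b * a * n + a * b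
count-close-beyond act@((γ≢0 , _) , _) n n≢0 γn≤a γn≤b =
  frac-close⇒ {{nonZero-≤ (γ≢0 n n≢0) γn≤a}} {{nonZero-≤ (γ≢0 n n≢0) γn≤b}} {{n≢0}}
    (close-beyond act n n≢0 γn≤a γn≤b)

-- Events whose count grows linearly

record LinearCount (e : Event) : Set where
  field
    den num err : ℕ
    den≢0 : NonZero den
    upper : ∀ m → den * count e m ≤ num * m + err
    lower : ∀ m → num * m ≤ den * count e m + err

module _ {e : Event} (lc : LinearCount e) where
  open LinearCount lc
  open ≤-Reasoning

  linearCount-close : ∀ {a b} n → 2 * err * n ≤ a → 2 * err * n ≤ b →
    count e a * b * n ≤ count e b * a * n + a * b
  linearCount-close {a} {b} n err≪a err≪b = *-cancelˡ-≤ den {{den≢0}} (begin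
    den * (Ca * b * n)                         ≡⟨ shape₁ den Ca b n ⟩
    (den * Ca) * (b * n)                       ≤⟨ *-monoˡ-≤ (b * n) (upper a) ⟩
    (num * a + err) * (b * n)                  ≡⟨ shape₂ num a err b n ⟩
    (num * b) * (a * n) + err * n * b          ≤⟨ +-monoˡ-≤ (err * n * b) (*-monoˡ-≤ (a * n) (lower b)) ⟩
    (den * Cb + err) * (a * n) + err * n * b   ≡⟨ shape₃ den Cb err a n b ⟩
    den * (Cb * a * n) + (err * n * a + err * n * b)
      ≤⟨ +-monoʳ-≤ (den * (Cb * a * n)) (≤-trans slack (m≤n*m (a * b) den {{den≢0}})) ⟩
    den * (Cb * a * n) + den * (a * b)         ≡⟨ *-distribˡ-+ den _ _ ⟨
    den * (Cb * a * n + a * b)                 ∎)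
    where
    Ca = count e a
    Cb = count e b
    shape₁ : ∀ d C b n → d * (C * b * n) ≡ (d * C) * (b * n)
    shape₁ = solve-∀
    shape₂ : ∀ c a E b n → (c * a + E) * (b * n) ≡ (c * b) * (a * n) + E * n * b
    shape₂ = solve-∀
    shape₃ : ∀ d C E a n b →
      (d * C + E) * (a * n) + E * n * b ≡ d * (C * a * n) + (E * n * a + E * n * b)
    shape₃ = solve-∀
    shape₄ : ∀ E n a b → 2 * (E * n * a + E * n * b) ≡ 2 * E * n * a + 2 * E * n * b
    shape₄ = solve-∀
    shape₅ : ∀ a b → b * a + a * b ≡ 2 * (a * b)
    shape₅ = solve-∀
    slack : err * n * a + err * n * b ≤ a * b
    slack = *-cancelˡ-≤ 2 (begin
      2 * (err * n * a + err * n * b)     ≡⟨ shape₄ err n a b ⟩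
      2 * err * n * a + 2 * err * n * b   ≤⟨ +-mono-≤ (*-monoˡ-≤ a err≪b) (*-monoˡ-≤ b err≪a) ⟩
      b * a + a * b                       ≡⟨ shape₅ a b ⟩
      2 * (a * b)                         ∎)

  spread : ℕ
  spread = 2 * suc err

  linearCount⇒Actual : Actual e (spread *_)
  linearCount⇒Actual =
    ((λ n n≢0 → m*n≢0 spread n {{_}} {{n≢0}}) , (λ _ _ _ _ → *-monoʳ-< spread)) , cauchy
    where
    err≪ : ∀ n i → 2 * err * n ≤ spread * n + i
    err≪ n i = ≤-trans (*-monoˡ-≤ n (*-monoʳ-≤ 2 (n≤1+n err))) (m≤m+n _ i)
    cauchy : ∀ n → NonZero n → ∀ i j →
      ℚ.∣ Φ e (spread * n + i) ℚ.- Φ e (spread * n + j) ∣ ℚ.≤ frac 1 n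
    cauchy n n≢0 i j = frac-close⇐ {{≢0 i}} {{≢0 j}} {{n≢0}}
        (linearCount-close n (err≪ n i) (err≪ n j)) (linearCount-close n (err≪ n j) (err≪ n i))
      where
      ≢0 : ∀ i → NonZero (spread * n + i)
      ≢0 i = nonZero-≤ (m*n≢0 spread n {{_}} {{n≢0}}) (m≤m+n _ i)

  linearCount⇒InA : InA e
  linearCount⇒InA = spread *_ , linearCount⇒Actual

  -- As num ≥ 1, γ n ≤ den · count + err; taking n ≥ 2 den and n > 2 err (so γ n > 2 err)
  -- turns this into γ n < 2 den · count ≤ count · n.
  linearCount⇒Positive : NonZero num → Holds Positive e
  linearCount⇒Positive num≢0 = linearCount⇒InA , λ γ act →
    n , n≢0 , frac1<frac {{nonZero-≤ n≢0 (index-≥ (proj₁ act) n n≢0)}} {{n≢0}} (beyond γ act)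
    where
    n = 2 * (den + err)
    den+err≢0 : NonZero (den + err)
    den+err≢0 = nonZero-≤ den≢0 (m≤m+n den err)
    n≢0 : NonZero n
    n≢0 = m*n≢0 2 (den + err) {{_}} {{den+err≢0}}
    2err<n : 2 * err < n
    2err<n = *-monoʳ-< 2 (m<n+m err (ℕ.>-nonZero⁻¹ den {{den≢0}}))
    beyond : ∀ γ → Actual e γ → γ n < count e (γ n) * n
    beyond γ act = begin-strict
      g             <⟨ +-cancelʳ-≤ (2 * err) (suc g) (2 * den * C) doubled ⟩
      2 * den * C   ≡⟨ reorder den C ⟩
      C * (2 * den) ≤⟨ *-monoʳ-≤ C (*-monoʳ-≤ 2 (m≤m+n den err)) ⟩
      C * n         ∎
      where
      g = γ n
      C = count e g
      g≤ : g ≤ den * C + err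
      g≤ = ≤-trans (m≤n*m g num {{num≢0}}) (lower g)
      twice : ∀ d C E → (d * C + E) + (d * C + E) ≡ 2 * d * C + 2 * E
      twice = solve-∀
      reorder : ∀ d C → 2 * d * C ≡ C * (2 * d)
      reorder = solve-∀
      doubled : suc g + 2 * err ≤ 2 * den * C + 2 * err
      doubled = begin
        suc g + 2 * err                   ≡⟨ +-suc g (2 * err) ⟨
        g + suc (2 * err)                 ≤⟨ +-monoʳ-≤ g (<-≤-trans 2err<n (index-≥ (proj₁ act) n n≢0)) ⟩
        g + g                             ≤⟨ +-mono-≤ g≤ g≤ ⟩
        (den * C + err) + (den * C + err) ≡⟨ twice den C err ⟩
        2 * den * C + 2 * err             ∎

boundedCount : ∀ {e} B → (∀ m → count e m ≤ B) → LinearCount e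
boundedCount B bounded = record
  { den = 1 ; num = 0 ; err = B ; den≢0 = _
  ; upper = λ m → ≤-trans (≤-reflexive (*-identityˡ _)) (bounded m)
  ; lower = λ _ → z≤n
  }

boundedCount⇒EqZero : ∀ {e γ} B → (∀ m → count e m ≤ B) → Actual e γ → EqZero (ℙ e γ)
boundedCount⇒EqZero {e} {γ} B bounded act n n≢0 =
  ∣frac∣≤frac2 {{g≢0}} {{n≢0}} (*-cancelʳ-≤ (count e g * n) (2 * g) m {{m≢0}} (begin
    count e g * n * m             ≡⟨ swap (count e g) n m ⟩
    count e g * m * n             ≤⟨ count-close-beyond act n n≢0 ≤-refl (m≤m+n g (B * n)) ⟩
    count e m * g * n + g * m     ≤⟨ +-monoˡ-≤ (g * m) far ⟩
    g * m + g * m                 ≡⟨ twice g m ⟩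
    2 * g * m                     ∎))
  where
  open ≤-Reasoning
  g = γ n
  g≢0 = proj₁ (proj₁ act) n n≢0
  m = g + B * n
  m≢0 = nonZero-≤ g≢0 (m≤m+n g (B * n))
  swap : ∀ C n m → C * n * m ≡ C * m * n
  swap = solve-∀
  reorder : ∀ B g n → B * g * n ≡ g * (B * n)
  reorder = solve-∀
  twice : ∀ g m → g * m + g * m ≡ 2 * g * m
  twice = solve-∀
  far : count e m * g * n ≤ g * m
  far = begin
    count e m * g * n ≤⟨ *-monoˡ-≤ n (*-monoˡ-≤ g (bounded m)) ⟩
    B * g * n         ≡⟨ reorder B g n ⟩
    g * (B * n)       ≤⟨ *-monoʳ-≤ g (m≤n+m (B * n) g) ⟩
    g * m             ∎

boundedCount⇒ℙ≈0 : ∀ {e} B → (∀ m → count e m ≤ B) → Holds EqZero e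
boundedCount⇒ℙ≈0 B bounded =
  linearCount⇒InA (boundedCount B bounded) , λ γ → boundedCount⇒EqZero B bounded

-- Eventually periodic events

module Periodic {e : Event} (p L : ℕ) (p≢0 : NonZero p)
                (periodic : ∀ i → L < i → e (p + i) ≡ e i) where

  gain : ℕ
  gain = count e (p + L) ∸ count e L

  gain≤p : gain ≤ p
  gain≤p = m≤n+o⇒m∸n≤o (count e (p + L)) (count e L) (count-+≤ e p L)

  count-shift-+ : ∀ d → count e (p + (d + L)) ≡ count e (d + L) + gain
  count-shift-+ zero    = sym (m+[n∸m]≡n (count-mono-+ e p L))
  count-shift-+ (suc d) = begin
    count e (p + suc (d + L))                            ≡⟨ cong (count e) (+-suc p (d + L)) ⟩
    count e (p + (d + L)) + bit (e (suc (p + (d + L)))) ≡⟨ cong₂ _+_ (count-shift-+ d) (cong bit next) ⟩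
    count e (d + L) + gain + bit (e (suc (d + L)))       ≡⟨ xy∙z≈xz∙y (count e (d + L)) gain _ ⟩
    count e (suc d + L) + gain                           ∎
    where
    open ≡-Reasoning
    next : e (suc (p + (d + L))) ≡ e (suc (d + L))
    next = trans (cong e (sym (+-suc p (d + L)))) (periodic (suc (d + L)) (s≤s (m≤n+m L d)))

  count-shift : ∀ m → L ≤ m → count e (p + m) ≡ count e m + gain
  count-shift m L≤m =
    subst (λ k → count e (p + k) ≡ count e k + gain) (m∸n+n≡m L≤m) (count-shift-+ (m ∸ L))

  err : ℕ
  err = p * (p + L)

  Bounds : ℕ → Set
  Bounds m = (p * count e m ≤ gain * m + err) × (gain * m ≤ p * count e m + err)

  initial-bounds : ∀ m → m < p + L → Bounds m
  initial-bounds m m<p+L = ≤-trans (≤-trans (*-monoʳ-≤ p (count≤ e m)) pm≤err) (m≤n+m err (gain * m))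
                         , ≤-trans (≤-trans (*-monoˡ-≤ m gain≤p) pm≤err) (m≤n+m err (p * count e m))
    where
    pm≤err : p * m ≤ err
    pm≤err = *-monoʳ-≤ p (<⇒≤ m<p+L)

  shifted-bounds : ∀ m → L ≤ m → Bounds m → Bounds (p + m)
  shifted-bounds m L≤m (upper , lower) =
    (begin
      p * count e (p + m)           ≡⟨ cong (p *_) (count-shift m L≤m) ⟩
      p * (count e m + gain)        ≡⟨ *-distribˡ-+ p (count e m) gain ⟩
      p * count e m + p * gain      ≤⟨ +-monoˡ-≤ (p * gain) upper ⟩
      gain * m + err + p * gain     ≡⟨ regroup₁ gain m err p ⟩
      gain * (p + m) + err          ∎) ,
    (begin
      gain * (p + m)                ≡⟨ regroup₂ gain p m ⟩
      gain * m + gain * p           ≤⟨ +-monoˡ-≤ (gain * p) lower ⟩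
      p * count e m + err + gain * p ≡⟨ regroup₃ p (count e m) err gain ⟩
      p * (count e m + gain) + err  ≡⟨ cong (λ k → p * k + err) (count-shift m L≤m) ⟨
      p * count e (p + m) + err     ∎)
    where
    open ≤-Reasoning
    regroup₁ : ∀ c m E p → c * m + E + p * c ≡ c * (p + m) + E
    regroup₁ = solve-∀
    regroup₂ : ∀ c p m → c * (p + m) ≡ c * m + c * p
    regroup₂ = solve-∀
    regroup₃ : ∀ p C E c → p * C + E + c * p ≡ p * (C + c) + E
    regroup₃ = solve-∀

  -- Below p + L the bounds hold because err = p (p + L); every later period adds
  -- exactly gain ones and p indices, so the bounds propagate.
  bounds : ∀ m → Bounds m
  bounds = <-rec Bounds step
    where
    step : ∀ m → (∀ {k} → k < m → Bounds k) → Bounds m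
    step m rec with m <? p + L
    ... | yes m<p+L = initial-bounds m m<p+L
    ... | no  m≮p+L = subst Bounds (m+[n∸m]≡n p≤m) (shifted-bounds (m ∸ p) L≤m∸p (rec m∸p<m))
      where
      p+L≤m = ≮⇒≥ m≮p+L
      p≤m = m+n≤o⇒m≤o p p+L≤m
      L≤m∸p = subst (_≤ m ∸ p) (m+n∸m≡n p L) (∸-monoˡ-≤ p p+L≤m)
      m∸p<m = ∸-monoʳ-< (ℕ.>-nonZero⁻¹ p {{p≢0}}) p≤m

  linearCount : LinearCount e
  linearCount = record
    { den = p ; num = gain ; err = err ; den≢0 = p≢0
    ; upper = λ m → proj₁ (bounds m)
    ; lower = λ m → proj₂ (bounds m)
    }

≤ᵇ-true : ∀ {i L} → i ≤ L → (i ≤ᵇ L) ≡ true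
≤ᵇ-true i≤L = Equivalence.to T-≡ (≤⇒≤ᵇ i≤L)

≤ᵇ-false : ∀ {i L} → L < i → (i ≤ᵇ L) ≡ false
≤ᵇ-false {i} {L} L<i with i ≤ᵇ L in eq
... | false = refl
... | true  = contradiction (≤ᵇ⇒≤ i L (subst T (sym eq) _)) (<⇒≱ L<i)

findTrue : (xs : List Bool) → (Σ ℕ λ k → k < length xs × at xs k ≡ true) ⊎ (∀ k → at xs k ≡ false)
findTrue []           = inj₂ λ _ → refl
findTrue (true ∷ xs)  = inj₁ (0 , s≤s z≤n , refl)
findTrue (false ∷ xs) with findTrue xs
... | inj₁ (k , k<n , hit) = inj₁ (suc k , s≤s k<n , hit)
... | inj₂ none            = inj₂ λ { zero → refl ; (suc k) → none k }

module EventuallyPeriodic (α : List Bool) (x : Bool) (xs : List Bool) {e : Event}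
                          (e≡ : ∀ i → NonZero i → e i ≡ ‖ α , x ∷ xs ‖ i) where

  π = x ∷ xs
  L = length α
  p = length π

  e-prefix : ∀ k → k < L → e (suc k) ≡ at α k
  e-prefix k k<L = trans (e≡ (suc k) _)
    (cong (if_then at α k else at π ((suc k ∸ L ∸ 1) % p)) (≤ᵇ-true k<L))

  e-tail : ∀ i → L < i → e i ≡ at π ((i ∸ L ∸ 1) % p)
  e-tail i L<i = trans (e≡ i (ℕ.>-nonZero (≤-<-trans z≤n L<i)))
    (cong (if_then at α (i ∸ 1) else at π ((i ∸ L ∸ 1) % p)) (≤ᵇ-false L<i))

  e-cycle : ∀ k → k < p → e (suc (k + L)) ≡ at π k
  e-cycle k k<p = trans (e-tail (suc (k + L)) (s≤s (m≤n+m L k)))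
    (cong (at π) (trans (cong (λ z → (z ∸ 1) % p) (m+n∸n≡m (suc k) L)) (m<n⇒m%n≡m k<p)))

  periodic : ∀ i → L < i → e (p + i) ≡ e i
  periodic i L<i = begin
    e (p + i)                      ≡⟨ e-tail (p + i) (≤-trans L<i (m≤n+m i p)) ⟩
    at π ((p + i ∸ L ∸ 1) % p)     ≡⟨ cong (λ z → at π (z % p)) shift ⟩
    at π ((i ∸ L ∸ 1 + p) % p)     ≡⟨ cong (at π) ([m+n]%n≡m%n (i ∸ L ∸ 1) p) ⟩
    at π ((i ∸ L ∸ 1) % p)         ≡⟨ e-tail i L<i ⟨
    e i                            ∎
    where
    open ≡-Reasoning
    shift : p + i ∸ L ∸ 1 ≡ i ∸ L ∸ 1 + p
    shift = begin
      p + i ∸ L ∸ 1     ≡⟨ cong (_∸ 1) (+-∸-assoc p (<⇒≤ L<i)) ⟩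
      p + (i ∸ L) ∸ 1   ≡⟨ +-∸-assoc p (m<n⇒0<n∸m L<i) ⟩
      p + (i ∸ L ∸ 1)   ≡⟨ +-comm p (i ∸ L ∸ 1) ⟩
      i ∸ L ∸ 1 + p     ∎

  open Periodic p L _ periodic public using (gain; linearCount)

  gain≢0 : ∀ k → k < p → at π k ≡ true → NonZero gain
  gain≢0 k k<p hit = ℕ.>-nonZero (m<n⇒0<n∸m (<-≤-trans (count-hit e k L (trans (e-cycle k k<p) hit))
    (subst (λ z → count e (suc (k + L)) ≤ count e z) rest (count-mono-+ e (p ∸ suc k) (suc (k + L))))))
    where
    rest : p ∸ suc k + suc (k + L) ≡ p + L
    rest = trans (sym (+-assoc (p ∸ suc k) (suc k) L)) (cong (_+ L) (m∸n+n≡m k<p))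

  false-beyond : (∀ k → at π k ≡ false) → ∀ i → L < i → e i ≡ false
  false-beyond none i L<i = trans (e-tail i L<i) (none ((i ∸ L ∸ 1) % p))

  all-false : (∀ k → at α k ≡ false) → (∀ k → at π k ≡ false) → ∀ i → NonZero i → e i ≡ false
  all-false noneα noneπ (suc k) _ with suc k ≤? L
  ... | yes k<L = trans (e-prefix k k<L) (noneα k)
  ... | no  k≮L = false-beyond noneπ (suc k) (≰⇒> k≮L)

  all-false-or-hit : (∀ i → NonZero i → e i ≡ false) ⊎ SomeOne e
  all-false-or-hit with findTrue α | findTrue π
  ... | inj₁ (k , k<L , hit) | _                    = inj₂ (suc k , _ , trans (e-prefix k k<L) hit)
  ... | inj₂ _               | inj₁ (k , k<p , hit) = inj₂ (suc (k + L) , _ , trans (e-cycle k k<p) hit)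
  ... | inj₂ noneα           | inj₂ noneπ           = inj₁ (all-false noneα noneπ)

  ℙ≈0-or-positive : Holds EqZero e ⊎ Holds Positive e
  ℙ≈0-or-positive with findTrue π
  ... | inj₁ (k , k<p , hit) = inj₂ (linearCount⇒Positive linearCount (gain≢0 k k<p hit))
  ... | inj₂ none            = inj₁ (boundedCount⇒ℙ≈0 L (count≤-false-beyond e L (false-beyond none)))

lpo-ℛ : LPO InR
lpo-ℛ e (α , []     , () , _)
lpo-ℛ e (α , x ∷ xs , _  , e≡) = EventuallyPeriodic.all-false-or-hit α x xs e≡

ℙ-lpo-ℛ : ℙ-LPO InR
ℙ-lpo-ℛ e e∈ℛ with lpo-ℛ e e∈ℛ
... | inj₁ none = inj₁ (boundedCount⇒ℙ≈0 0 (count≤-false-beyond e 0 λ i 0<i → none i (ℕ.>-nonZero 0<i)))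
... | inj₂ hit  = inj₂ hit

ℙℙ-lpo-ℛ : ℙℙ-LPO InR
ℙℙ-lpo-ℛ e (α , []     , () , _)
ℙℙ-lpo-ℛ e (α , x ∷ xs , _  , e≡) = EventuallyPeriodic.ℙ≈0-or-positive α x xs e≡

-- An event without a frequency

Oscillating : Event → Set
Oscillating e = ∀ N → Σ ℕ λ a → Σ ℕ λ b →
  N ≤ a × N ≤ b × 4 * count e a ≤ a × 3 * b ≤ 4 * count e b

frequencies-far-apart : ∀ {a b Ca Cb} → NonZero a → NonZero b → 4 * Ca ≤ a → 3 * b ≤ 4 * Cb →
  ¬ (Cb * a * 3 ≤ Ca * b * 3 + b * a)
frequencies-far-apart {a} {b} {Ca} {Cb} a≢0 b≢0 rare frequent close =
  <⇒≱ (*-monoˡ-< (a * b) {{m*n≢0 a b {{a≢0}} {{b≢0}}}} {7} {9} (n≤1+n 8)) (begin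
    9 * (a * b)                   ≡⟨ shape₁ b a ⟨
    3 * (3 * b) * a               ≤⟨ *-monoˡ-≤ a (*-monoʳ-≤ 3 frequent) ⟩
    3 * (4 * Cb) * a              ≡⟨ shape₂ Cb a ⟩
    4 * (Cb * a * 3)              ≤⟨ *-monoʳ-≤ 4 close ⟩
    4 * (Ca * b * 3 + b * a)      ≡⟨ shape₃ Ca b a ⟩
    3 * b * (4 * Ca) + 4 * (a * b) ≤⟨ +-monoˡ-≤ (4 * (a * b)) (*-monoʳ-≤ (3 * b) rare) ⟩
    3 * b * a + 4 * (a * b)       ≡⟨ shape₄ b a ⟩
    7 * (a * b)                   ∎)
  where
  open ≤-Reasoning
  shape₁ : ∀ b a → 3 * (3 * b) * a ≡ 9 * (a * b)
  shape₁ = solve-∀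
  shape₂ : ∀ Cb a → 3 * (4 * Cb) * a ≡ 4 * (Cb * a * 3)
  shape₂ = solve-∀
  shape₃ : ∀ Ca b a → 4 * (Ca * b * 3 + b * a) ≡ 3 * b * (4 * Ca) + 4 * (a * b)
  shape₃ = solve-∀
  shape₄ : ∀ b a → 3 * b * a + 4 * (a * b) ≡ 7 * (a * b)
  shape₄ = solve-∀

oscillating⇒¬InA : ∀ {e} → Oscillating e → ¬ InA e
oscillating⇒¬InA osc (γ , act@((γ≢0 , _) , _)) with osc (γ 3)
... | a , b , γ3≤a , γ3≤b , rare , frequent =
  frequencies-far-apart {Ca = count _ a} {Cb = count _ b}
    (nonZero-≤ (γ≢0 3 _) γ3≤a) (nonZero-≤ (γ≢0 3 _) γ3≤b) rare frequent
    (count-close-beyond act 3 _ γ3≤b γ3≤a)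

log₄-fuel : ℕ → ℕ → ℕ
log₄-fuel zero    i = 0
log₄-fuel (suc f) i with i <? 4
... | yes _ = 0
... | no  _ = suc (log₄-fuel f (i / 4))

⌊log₄_⌋ : ℕ → ℕ
⌊log₄ i ⌋ = log₄-fuel i i

n<4^n : ∀ n → n < 4 ^ n
n<4^n zero    = s≤s z≤n
n<4^n (suc n) = <-≤-trans (s≤s (n<4^n n))
  (subst (_< 4 * 4 ^ n) (*-identityˡ (4 ^ n)) (*-monoˡ-< (4 ^ n) {{m^n≢0 4 n}} {1} {4} (s≤s (s≤s z≤n))))

log₄-fuel-exact : ∀ k f i → k ≤ f → 4 ^ k ≤ i → i < 4 * 4 ^ k → log₄-fuel f i ≡ k
log₄-fuel-exact zero    zero    i _ _ _ = refl
log₄-fuel-exact zero    (suc f) i _ _ i<4 with i <? 4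
... | yes _   = refl
... | no  i≮4 = contradiction i<4 i≮4
log₄-fuel-exact (suc k) (suc f) i (s≤s k≤f) lo hi with i <? 4
... | yes i<4 = contradiction (≤-trans (*-monoʳ-≤ 4 (m^n>0 4 k)) lo) (<⇒≱ i<4)
... | no  _   = cong suc (log₄-fuel-exact k f (i / 4) k≤f lo′ hi′)
  where
  lo′ : 4 ^ k ≤ i / 4
  lo′ = subst (_≤ i / 4) (m*n/n≡m (4 ^ k) 4) (/-monoˡ-≤ 4 (subst (_≤ i) (*-comm 4 (4 ^ k)) lo))
  hi′ : i / 4 < 4 * 4 ^ k
  hi′ = m<n*o⇒m/o<n (subst (i <_) (*-comm 4 (4 * 4 ^ k)) hi)

⌊log₄⌋-exact : ∀ k i → 4 ^ k ≤ i → i < 4 * 4 ^ k → ⌊log₄ i ⌋ ≡ k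
⌊log₄⌋-exact k i lo hi = log₄-fuel-exact k i i (≤-trans (<⇒≤ (n<4^n k)) lo) lo hi

odd : ℕ → Bool
odd zero    = false
odd (suc n) = not (odd n)

odd-2* : ∀ j → odd (2 * j) ≡ false
odd-2* zero    = refl
odd-2* (suc j) = subst (λ n → odd n ≡ false) (sym (+-suc (suc j) (j + 0))) (cong (not ∘ not) (odd-2* j))

oscillating : Event
oscillating zero    = false
oscillating (suc i) = odd ⌊log₄ i ⌋

module OscillatingBlocks (j : ℕ) where

  M : ℕ
  M = 4 ^ (2 * j)

  zeros : ∀ t → t < 3 * M → oscillating (suc (t + M)) ≡ false
  zeros t t<3M = trans (cong odd (⌊log₄⌋-exact (2 * j) (t + M) (m≤n+m M t) t+M<4M)) (odd-2* j)
    where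
    t+M<4M : t + M < 4 * M
    t+M<4M = subst (t + M <_) (regroup M) (+-monoˡ-< M t<3M)
      where
      regroup : ∀ M → 3 * M + M ≡ 4 * M
      regroup = solve-∀

  ones : ∀ t → t < 12 * M → oscillating (suc (t + 4 * M)) ≡ true
  ones t t<12M = trans (cong odd (⌊log₄⌋-exact (suc (2 * j)) (t + 4 * M) (m≤n+m (4 * M) t) t+4M<16M))
    (cong not (odd-2* j))
    where
    t+4M<16M : t + 4 * M < 4 * (4 * M)
    t+4M<16M = subst (t + 4 * M <_) (regroup M) (+-monoˡ-< (4 * M) t<12M)
      where
      regroup : ∀ M → 12 * M + 4 * M ≡ 4 * (4 * M)
      regroup = solve-∀

  sparse : 4 * count oscillating (4 * M) ≤ 4 * M
  sparse = *-monoʳ-≤ 4 (begin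
    count oscillating (4 * M)      ≡⟨ cong (count oscillating) (regroup M) ⟩
    count oscillating (3 * M + M)  ≡⟨ count-false-block oscillating (3 * M) M zeros ⟩
    count oscillating M            ≤⟨ count≤ oscillating M ⟩
    M                              ∎)
    where
    open ≤-Reasoning
    regroup : ∀ M → 4 * M ≡ 3 * M + M
    regroup = solve-∀

  dense : 3 * (16 * M) ≤ 4 * count oscillating (16 * M)
  dense = begin
    3 * (16 * M)                     ≡⟨ regroup₁ M ⟩
    4 * (12 * M)                     ≤⟨ *-monoʳ-≤ 4 (m≤n+m (12 * M) (count oscillating (4 * M))) ⟩
    4 * (count oscillating (4 * M) + 12 * M)
      ≡⟨ cong (4 *_) (count-true-block oscillating (12 * M) (4 * M) ones) ⟨
    4 * count oscillating (12 * M + 4 * M) ≡⟨ cong (λ n → 4 * count oscillating n) (regroup₂ M) ⟩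
    4 * count oscillating (16 * M)   ∎
    where
    open ≤-Reasoning
    regroup₁ : ∀ M → 3 * (16 * M) ≡ 4 * (12 * M)
    regroup₁ = solve-∀
    regroup₂ : ∀ M → 12 * M + 4 * M ≡ 16 * M
    regroup₂ = solve-∀

oscillating-oscillates : Oscillating oscillating
oscillating-oscillates N =
  4 * M , 16 * M , ≤-trans N≤M (m≤n*m M 4) , ≤-trans N≤M (m≤n*m M 16) , sparse , dense
  where
  open OscillatingBlocks N
  N≤M : N ≤ M
  N≤M = ≤-trans (m≤n*m N 2) (<⇒≤ (n<4^n (2 * N)))

mainTheorem17 : LPO InR × ℙ-LPO InR × ℙℙ-LPO InR × ℙℙ-LPO InN × ℙ-LPO InN
                  × ¬ ℙℙ-LPO InP
mainTheorem17 =
  lpo-ℛ , ℙ-lpo-ℛ , ℙℙ-lpo-ℛ , (λ _ → inj₁) , (λ _ → inj₁) ,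
  λ ℙℙ-lpo → oscillating⇒¬InA oscillating-oscillates ([ proj₁ , proj₁ ] (ℙℙ-lpo oscillating tt))
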